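{- Let $\Sigma$ be a well-formed LF signature, $\Gamma$ a context such that $\vdash\Gamma\ \mathrm{ctx}$ is derivable, and $\Theta$ the arity context induced by $\Sigma$ and $\Gamma$. Suppose $\Pi y_1{:}A_1.\ldots\Pi y_n{:}A_n.A$ is a type associated with a term constant or variable by $\Sigma$ or $\Gamma$, or $\Pi y_1{:}A_1.\ldots\Pi y_n{:}A_n.K$ is a kind associated with a type constant by $\Sigma$, where $y_1,\ldots,y_n$ are distinct variables. Then for $1\le i\le n$, $A_i$ and $\Pi y_i{:}A_i.\ldots\Pi y_n{:}A_n.A$ (respectively $\Pi y_i{:}A_i.\ldots\Pi y_n{:}A_n.K$) respect the arity context $\{y_1:A_1^-,\ldots,y_{i-1}:A_{i-1}^-\}\oplus\Theta$. Further, $A$ (respectively $K$) respects $\{y_1:A_1^-,\ldots,y_n:A_n^-\}\oplus\Theta$.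
   Context: Canonical LF syntax: kinds $K::=\mathrm{Type}\mid\Pi x{:}A.K$; types $A::=P\mid\Pi x{:}A.B$; atomic types $P::=a\mid P\,M$; canonical terms $M::=R\mid\lambda x.M$; atomic terms $R::=c\mid x\mid R\,M$; signatures $\Sigma::=\cdot\mid\Sigma,c{:}A\mid\Sigma,a{:}K$; contexts $\Gamma::=\cdot\mid\Gamma,x{:}A$. Arity types from $o$ and $\rightarrow$; erasure $P^-=o$, $(\Pi x{:}A_1.A_2)^-=A_1^-\rightarrow A_2^-$. LF judgements $\vdash\Gamma\ \mathrm{ctx}$, $\Gamma\vdash K\ \mathrm{kind}$, $\Gamma\vdash A\ \mathrm{type}$, $\Gamma\vdash P\Rightarrow K$, $\Gamma\vdash M\Leftarrow A$, $\Gamma\vdash R\Rightarrow A$ are given by the canonical LF rules: $\vdash\Gamma,x{:}A\ \mathrm{ctx}$ from $\vdash\Gamma\ \mathrm{ctx}$, $\Gamma\vdash A\ \mathrm{type}$, $x$ fresh; $\Pi$-kinds and $\Pi$-types are well-formed if the domain type is and the body is in the extended context; $\Gamma\vdash P\ \mathrm{type}$ iff $\Gamma\vdash P\Rightarrow\mathrm{Type}$; $\Gamma\vdash a\Rightarrow K$ for $a{:}K\in\Sigma$; $\Gamma\vdash P\,M\Rightarrow K$ if $\Gamma\vdash P\Rightarrow\Pi x{:}A.K_1$, $\Gamma\vdash M\Leftarrow A$, $[\{\langle x,M,A^-\rangle\}]K_1=K$; $\Gamma\vdash R\Leftarrow P$ if $\Gamma\vdash R\Rightarrow P$; $\Gamma\vdash\lambda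 x.M\Leftarrow\Pi x{:}A_1.A_2$ if $\Gamma,x{:}A_1\vdash M\Leftarrow A_2$; variables/constants synthesize their declared types; $\Gamma\vdash R\,M\Rightarrow A$ if $\Gamma\vdash R\Rightarrow\Pi x{:}A_1.A_2$, $\Gamma\vdash M\Leftarrow A_1$, $[\{\langle x,M,A_1^-\rangle\}]A_2=A$ (hereditary substitution, which replaces $x$ and normalizes $\beta$-redexes). $\Sigma$ is well-formed if its constants are distinct and each declared type/kind is well-formed in the empty context relative to the preceding declarations. Arity context: set of unique assignments of arity types to constants and variables; $\Theta_1\oplus\Theta_2$ = $\Theta_1$ plus assignments of $\Theta_2$ to symbols not assigned in $\Theta_1$. Arity typing: $\Theta\vdash h\Rightarrow\alpha$ for $h:\alpha\in\Theta$; $\Theta\vdash R\,M\Rightarrow\alpha$ if $\Theta\vdash R\Rightarrow\alpha'\rightarrow\alpha$, $\Theta\vdash M:\alpha'$; $\Theta\vdash\lambda x.M:\alpha_1\rightarrow\alpha_2$ if $\{x:\alpha_1\}\oplus\Theta\vdash M:\alpha_2$; $\Theta\vdash R:o$ if $\Theta\vdash R\Rightarrow o$. A kind/type respects $\Theta$ if it is $\mathrm{Type}$, or atomic with every canonical term in it arity-typable under $\Theta$, or $\Pi x{:}A.E'$ with $A$ respecting $\Theta$ and $E'$ respecting $\{x:A^-\}\oplus\Theta$. The arity context induced by $\Sigma$ and $\Gamma$ contains $x:A^-$ for $x{:}A\in\Gamma$ and $c:A^-$ for $c{:}A\in\Sigma$. -}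

module Defs where

open import Data.Nat using (ℕ; zero; suc; _+_; _<_; pred; _≟_)
open import Data.List using (List; []; _∷_; map; take; drop; length; lookup)
open import Data.List.Membership.Propositional using (_∉_)
open import Data.Maybe using (Maybe; just; nothing)
import Data.Maybe as Maybe
open import Data.Product using (_×_; ∃)
open import Data.Unit using (⊤)
open import Relation.Binary.PropositionalEquality using (_≡_)
open import Relation.Nullary using (yes; no)

-- Canonical LF syntax, with de Bruijn indices for (term) variables.
-- Variable  i  refers to the i-th enclosing binder / context entry
-- (0 = most recent).

data Ar : Set where
  o   : Ar
  _⇒_ : Ar → Ar → Ar

infixr 5 _⇒_

mutual
  data Tm : Set where
    at  : ATm → Tm
    lam : Tm → Tm          -- binds variable 0 in the body

  data ATm : Set where
    con : ℕ → ATm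
    var : ℕ → ATm
    app : ATm → Tm → ATm

data ATy : Set where
  tcon : ℕ → ATy
  tapp : ATy → Tm → ATy

-- types  A ::= P | Πx:A.B   (pi A B binds variable 0 in B)
data Ty : Set where
  atm : ATy → Ty
  pi  : Ty → Ty → Ty

data Kd : Set where
  type : Kd
  kpi  : Ty → Kd → Kd

-- signature declarations and signatures (head of list = last declaration)
data Decl : Set where
  tmc : ℕ → Ty → Decl
  tyc : ℕ → Kd → Decl

Sig : Set
Sig = List Decl

-- contexts (head of list = last, i.e. innermost, declaration)
Ctx : Set
Ctx = List Ty

declName : Decl → ℕ
declName (tmc c _) = c
declName (tyc a _) = a

erase : Ty → Ar
erase (atm _)  = o
erase (pi A B) = erase A ⇒ erase B

ext : (ℕ → ℕ) → ℕ → ℕ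
ext ρ zero    = zero
ext ρ (suc i) = suc (ρ i)

mutual
  renTm : (ℕ → ℕ) → Tm → Tm
  renTm ρ (at R)  = at (renATm ρ R)
  renTm ρ (lam M) = lam (renTm (ext ρ) M)

  renATm : (ℕ → ℕ) → ATm → ATm
  renATm ρ (con c)   = con c
  renATm ρ (var i)   = var (ρ i)
  renATm ρ (app R M) = app (renATm ρ R) (renTm ρ M)

renATy : (ℕ → ℕ) → ATy → ATy
renATy ρ (tcon a)   = tcon a
renATy ρ (tapp P M) = tapp (renATy ρ P) (renTm ρ M)

renTy : (ℕ → ℕ) → Ty → Ty
renTy ρ (atm P)  = atm (renATy ρ P)
renTy ρ (pi A B) = pi (renTy ρ A) (renTy (ext ρ) B)

wkTy : Ty → Ty
wkTy = renTy suc

-- Hereditary substitution [{⟨x,N,α⟩}]E = E', as a relation.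
-- HS… k N α E E' : substitute N (living in the outer context) for the
-- variable with index k (k = number of binders passed so far) in E,
-- with arity type α.  Variables below k are local and unchanged,
-- variables above k are decremented.

-- result of substituting into an atomic term: either an atomic term
-- (head not replaced) or a canonical term together with its arity type
data AResult : Set where
  atomR : ATm → AResult
  headR : Tm → Ar → AResult

mutual
  data HSA (k : ℕ) (N : Tm) (α : Ar) : ATm → AResult → Set where
    hs-con  : ∀ {c} → HSA k N α (con c) (atomR (con c))
    hs-var< : ∀ {i} → i < k → HSA k N α (var i) (atomR (var i))
    hs-var> : ∀ {i} → k < i → HSA k N α (var i) (atomR (var (pred i)))
    hs-var≡ : HSA k N α (var k) (headR (renTm (k +_) N) α)
    hs-app₁ : ∀ {R R' M M'} →
              HSA k N α R (atomR R') → HSC k N α M M' →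
              HSA k N α (app R M) (atomR (app R' M'))
    hs-app₂ : ∀ {R M M₁ M' M'' α₁ α₂} →
              HSA k N α R (headR (lam M₁) (α₁ ⇒ α₂)) → HSC k N α M M' →
              HSC 0 M' α₁ M₁ M'' →
              HSA k N α (app R M) (headR M'' α₂)

  data HSC (k : ℕ) (N : Tm) (α : Ar) : Tm → Tm → Set where
    hsc-at   : ∀ {R R'} → HSA k N α R (atomR R') → HSC k N α (at R) (at R')
    hsc-head : ∀ {R M'} → HSA k N α R (headR M' o) → HSC k N α (at R) M'
    hsc-lam  : ∀ {M M'} → HSC (suc k) N α M M' → HSC k N α (lam M) (lam M')

data HSP (k : ℕ) (N : Tm) (α : Ar) : ATy → ATy → Set where
  hsp-con : ∀ {a} → HSP k N α (tcon a) (tcon a)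
  hsp-app : ∀ {P P' M M'} → HSP k N α P P' → HSC k N α M M' →
            HSP k N α (tapp P M) (tapp P' M')

data HST (k : ℕ) (N : Tm) (α : Ar) : Ty → Ty → Set where
  hst-atm : ∀ {P P'} → HSP k N α P P' → HST k N α (atm P) (atm P')
  hst-pi  : ∀ {A A' B B'} → HST k N α A A' → HST (suc k) N α B B' →
            HST k N α (pi A B) (pi A' B')

data HSK (k : ℕ) (N : Tm) (α : Ar) : Kd → Kd → Set where
  hsk-type : HSK k N α type type
  hsk-pi   : ∀ {A A' K K'} → HST k N α A A' → HSK (suc k) N α K K' →
             HSK k N α (kpi A K) (kpi A' K')

sigTy : Sig → ℕ → Maybe Ty
sigTy [] c = nothing
sigTy (tmc d A ∷ Σ) c with d ≟ c
... | yes _ = just A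
... | no  _ = sigTy Σ c
sigTy (tyc _ _ ∷ Σ) c = sigTy Σ c

sigKd : Sig → ℕ → Maybe Kd
sigKd [] a = nothing
sigKd (tyc d K ∷ Σ) a with d ≟ a
... | yes _ = just K
... | no  _ = sigKd Σ a
sigKd (tmc _ _ ∷ Σ) a = sigKd Σ a

-- type of variable i in Γ, weakened to live in Γ
ctxLookup : Ctx → ℕ → Maybe Ty
ctxLookup [] i = nothing
ctxLookup (A ∷ Γ) zero    = just (wkTy A)
ctxLookup (A ∷ Γ) (suc i) = Maybe.map wkTy (ctxLookup Γ i)

mutual
  data IsKind (Σ : Sig) (Γ : Ctx) : Kd → Set where
    k-type : IsKind Σ Γ type
    k-pi   : ∀ {A K} → IsType Σ Γ A → IsKind Σ (A ∷ Γ) K → IsKind Σ Γ (kpi A K)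

  data IsType (Σ : Sig) (Γ : Ctx) : Ty → Set where
    t-atm : ∀ {P} → SynP Σ Γ P type → IsType Σ Γ (atm P)
    t-pi  : ∀ {A B} → IsType Σ Γ A → IsType Σ (A ∷ Γ) B → IsType Σ Γ (pi A B)

  data SynP (Σ : Sig) (Γ : Ctx) : ATy → Kd → Set where
    p-con : ∀ {a K} → sigKd Σ a ≡ just K → SynP Σ Γ (tcon a) K
    p-app : ∀ {P M A K₁ K} → SynP Σ Γ P (kpi A K₁) → Chk Σ Γ M A →
            HSK 0 M (erase A) K₁ K → SynP Σ Γ (tapp P M) K

  data Chk (Σ : Sig) (Γ : Ctx) : Tm → Ty → Set where
    c-at  : ∀ {R P} → Syn Σ Γ R (atm P) → Chk Σ Γ (at R) (atm P)
    c-lam : ∀ {M A₁ A₂} → Chk Σ (A₁ ∷ Γ) M A₂ → Chk Σ Γ (lam M) (pi A₁ A₂)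

  data Syn (Σ : Sig) (Γ : Ctx) : ATm → Ty → Set where
    s-con : ∀ {c A} → sigTy Σ c ≡ just A → Syn Σ Γ (con c) A
    s-var : ∀ {i A} → ctxLookup Γ i ≡ just A → Syn Σ Γ (var i) A
    s-app : ∀ {R M A₁ A₂ A} → Syn Σ Γ R (pi A₁ A₂) → Chk Σ Γ M A₁ →
            HST 0 M (erase A₁) A₂ A → Syn Σ Γ (app R M) A

-- ⊢ Γ ctx   (freshness of the new variable is automatic with de Bruijn)
data CtxOK (Σ : Sig) : Ctx → Set where
  ctx-nil  : CtxOK Σ []
  ctx-cons : ∀ {Γ A} → CtxOK Σ Γ → IsType Σ Γ A → CtxOK Σ (A ∷ Γ)

data SigOK : Sig → Set where
  sig-nil : SigOK []
  sig-tm  : ∀ {Σ c A} → SigOK Σ → c ∉ map declName Σ → IsType Σ [] A →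
            SigOK (tmc c A ∷ Σ)
  sig-ty  : ∀ {Σ a K} → SigOK Σ → a ∉ map declName Σ → IsKind Σ [] K →
            SigOK (tyc a K ∷ Σ)

record ArCtx : Set where
  field
    consAr : ℕ → Maybe Ar
    varsAr : List Ar          -- assignments to variables (index 0 first)
open ArCtx public

-- {x : α} ⊕ Θ  for a newly bound variable x (index 0)
extAr : Ar → ArCtx → ArCtx
extAr α Θ = record { consAr = consAr Θ ; varsAr = α ∷ varsAr Θ }

lookupAr : List Ar → ℕ → Maybe Ar
lookupAr [] i = nothing
lookupAr (α ∷ αs) zero    = just α
lookupAr (α ∷ αs) (suc i) = lookupAr αs i

mutual
  data ArSyn (Θ : ArCtx) : ATm → Ar → Set where
    ar-con : ∀ {c α} → consAr Θ c ≡ just α → ArSyn Θ (con c) α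
    ar-var : ∀ {i α} → lookupAr (varsAr Θ) i ≡ just α → ArSyn Θ (var i) α
    ar-app : ∀ {R M α' α} → ArSyn Θ R (α' ⇒ α) → ArChk Θ M α' → ArSyn Θ (app R M) α

  data ArChk (Θ : ArCtx) : Tm → Ar → Set where
    ar-lam : ∀ {M α₁ α₂} → ArChk (extAr α₁ Θ) M α₂ → ArChk Θ (lam M) (α₁ ⇒ α₂)
    ar-at  : ∀ {R} → ArSyn Θ R o → ArChk Θ (at R) o

RespP : ArCtx → ATy → Set
RespP Θ (tcon a)   = ⊤
RespP Θ (tapp P M) = RespP Θ P × ∃ (λ α → ArChk Θ M α)

RespT : ArCtx → Ty → Set
RespT Θ (atm P)  = RespP Θ P
RespT Θ (pi A B) = RespT Θ A × RespT (extAr (erase A) Θ) B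

RespK : ArCtx → Kd → Set
RespK Θ type      = ⊤
RespK Θ (kpi A K) = RespT Θ A × RespK (extAr (erase A) Θ) K

sigAr : Sig → ℕ → Maybe Ar
sigAr Σ c = Maybe.map erase (sigTy Σ c)

induced : Sig → Ctx → ArCtx
induced Σ Γ = record { consAr = sigAr Σ ; varsAr = map erase Γ }

Πs : List Ty → Ty → Ty
Πs [] A = A
Πs (B ∷ Bs) A = pi B (Πs Bs A)

Πks : List Ty → Kd → Kd
Πks [] K = K
Πks (B ∷ Bs) K = kpi B (Πks Bs K)

-- {y₁:A₁⁻,…,yₙ:Aₙ⁻} ⊕ Θ  (yₙ becomes index 0)
extMany : List Ty → ArCtx → ArCtx
extMany [] Θ = Θ
extMany (B ∷ Bs) Θ = extMany Bs (extAr (erase B) Θ)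

data AssocTy (Σ : Sig) (Γ : Ctx) (A : Ty) : Set where
  by-con : ∀ c → sigTy Σ c ≡ just A → AssocTy Σ Γ A
  by-var : ∀ i → ctxLookup Γ i ≡ just A → AssocTy Σ Γ A

{-# OPTIONS --safe #-}
module Submission where

-- Every well-formed type or kind respects the arity context induced by its
-- signature and context, because a typing derivation erases to an arity
-- derivation. A type or kind declared in Σ was checked against the part of Σ
-- preceding it, whose induced arity context is included in the full one since
-- constant names are distinct; a type declared in Γ is weakened by ctxLookup,
-- which renaming preserves. Peeling the Π-prefix then yields the statement.

open import Defs
open import Data.Nat using (ℕ; zero; suc; _≟_)
open import Data.Fin using (Fin; toℕ)
import Data.Fin as Fin
open import Data.List using (List; []; _∷_; map; length; lookup; take; drop)
open import Data.List.Membership.Propositional using (_∈_; _∉_)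
open import Data.List.Relation.Unary.Any using (here; there)
open import Data.Maybe using (just; nothing)
import Data.Maybe as Maybe
open import Data.Maybe.Properties using (map-cong; map-∘)
open import Data.Product using (_×_; _,_)
open import Data.Unit using (tt)
open import Data.Empty using (⊥-elim)
open import Function using (id)
open import Relation.Nullary using (yes; no)
open import Relation.Binary.PropositionalEquality
  using (_≡_; refl; sym; trans; cong; cong₂; subst)

erase-renTy : ∀ ρ A → erase (renTy ρ A) ≡ erase A
erase-renTy ρ (atm P)  = refl
erase-renTy ρ (pi A B) = cong₂ _⇒_ (erase-renTy ρ A) (erase-renTy (ext ρ) B)

erase-HST : ∀ {k N α A B} → HST k N α A B → erase B ≡ erase A
erase-HST (hst-atm _)   = refl
erase-HST (hst-pi h g) = cong₂ _⇒_ (erase-HST h) (erase-HST g)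

lookupAr-map-erase : ∀ Γ i → lookupAr (map erase Γ) i ≡ Maybe.map erase (ctxLookup Γ i)
lookupAr-map-erase []      i       = refl
lookupAr-map-erase (A ∷ Γ) zero    = cong just (sym (erase-renTy suc A))
lookupAr-map-erase (A ∷ Γ) (suc i) = begin
  lookupAr (map erase Γ) i                        ≡⟨ lookupAr-map-erase Γ i ⟩
  Maybe.map erase (ctxLookup Γ i)                 ≡⟨ map-cong (λ B → sym (erase-renTy suc B)) (ctxLookup Γ i) ⟩
  Maybe.map (λ B → erase (wkTy B)) (ctxLookup Γ i) ≡⟨ map-∘ (ctxLookup Γ i) ⟩
  Maybe.map erase (Maybe.map wkTy (ctxLookup Γ i)) ∎
  where open Relation.Binary.PropositionalEquality.≡-Reasoning

record Renaming (ρ : ℕ → ℕ) (Θ Θ′ : ArCtx) : Set where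
  field
    con-preserved : ∀ {c α} → consAr Θ c ≡ just α → consAr Θ′ c ≡ just α
    var-renamed   : ∀ {i α} → lookupAr (varsAr Θ) i ≡ just α → lookupAr (varsAr Θ′) (ρ i) ≡ just α
open Renaming

_⊑_ : ArCtx → ArCtx → Set
Θ ⊑ Θ′ = Renaming id Θ Θ′

Renaming-ext : ∀ {ρ Θ Θ′ β} → Renaming ρ Θ Θ′ → Renaming (ext ρ) (extAr β Θ) (extAr β Θ′)
Renaming-ext r .con-preserved = r .con-preserved
Renaming-ext r .var-renamed {zero}  = id
Renaming-ext r .var-renamed {suc i} = r .var-renamed

-- Not an instance of Renaming-ext: ext id agrees with id only pointwise.
⊑-extAr : ∀ {Θ Θ′ β} → Θ ⊑ Θ′ → extAr β Θ ⊑ extAr β Θ′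
⊑-extAr s .con-preserved = s .con-preserved
⊑-extAr s .var-renamed {zero}  = id
⊑-extAr s .var-renamed {suc i} = s .var-renamed

⊑-refl : ∀ {Θ} → Θ ⊑ Θ
⊑-refl .con-preserved = id
⊑-refl .var-renamed   = id

⊑-trans : ∀ {Θ₁ Θ₂ Θ₃} → Θ₁ ⊑ Θ₂ → Θ₂ ⊑ Θ₃ → Θ₁ ⊑ Θ₃
⊑-trans s t .con-preserved e = t .con-preserved (s .con-preserved e)
⊑-trans s t .var-renamed   e = t .var-renamed (s .var-renamed e)

mutual
  ArSyn-rename : ∀ {ρ Θ Θ′ R α} → Renaming ρ Θ Θ′ → ArSyn Θ R α → ArSyn Θ′ (renATm ρ R) α
  ArSyn-rename r (ar-con e)   = ar-con (r .con-preserved e)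
  ArSyn-rename r (ar-var e)   = ar-var (r .var-renamed e)
  ArSyn-rename r (ar-app s c) = ar-app (ArSyn-rename r s) (ArChk-rename r c)

  ArChk-rename : ∀ {ρ Θ Θ′ M α} → Renaming ρ Θ Θ′ → ArChk Θ M α → ArChk Θ′ (renTm ρ M) α
  ArChk-rename r (ar-lam c) = ar-lam (ArChk-rename (Renaming-ext r) c)
  ArChk-rename r (ar-at s)  = ar-at (ArSyn-rename r s)

RespP-rename : ∀ {ρ Θ Θ′} P → Renaming ρ Θ Θ′ → RespP Θ P → RespP Θ′ (renATy ρ P)
RespP-rename (tcon a)   r tt            = tt
RespP-rename (tapp P M) r (p , (α , c)) = RespP-rename P r p , (α , ArChk-rename r c)

RespT-rename : ∀ {ρ Θ Θ′} A → Renaming ρ Θ Θ′ → RespT Θ A → RespT Θ′ (renTy ρ A)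
RespT-rename (atm P) r p = RespP-rename P r p
RespT-rename {ρ} {Θ′ = Θ′} (pi A B) r (a , b) =
  RespT-rename A r a ,
  subst (λ β → RespT (extAr β Θ′) (renTy (ext ρ) B)) (sym (erase-renTy ρ A))
        (RespT-rename B (Renaming-ext r) b)

-- induced Σ (B ∷ Γ) is definitionally extAr (erase B) (induced Σ Γ), so ⊑-extAr handles λ.
mutual
  Syn⇒ArSyn : ∀ {Σ Γ Θ R A} → induced Σ Γ ⊑ Θ → Syn Σ Γ R A → ArSyn Θ R (erase A)
  Syn⇒ArSyn s (s-con e) = ar-con (s .con-preserved (cong (Maybe.map erase) e))
  Syn⇒ArSyn {Γ = Γ} {R = var i} s (s-var e) =
    ar-var (s .var-renamed (trans (lookupAr-map-erase Γ i) (cong (Maybe.map erase) e)))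
  Syn⇒ArSyn s (s-app r c h) =
    subst (ArSyn _ _) (sym (erase-HST h)) (ar-app (Syn⇒ArSyn s r) (Chk⇒ArChk s c))

  Chk⇒ArChk : ∀ {Σ Γ Θ M A} → induced Σ Γ ⊑ Θ → Chk Σ Γ M A → ArChk Θ M (erase A)
  Chk⇒ArChk s (c-at r)  = ar-at (Syn⇒ArSyn s r)
  Chk⇒ArChk s (c-lam c) = ar-lam (Chk⇒ArChk (⊑-extAr s) c)

SynP⇒RespP : ∀ {Σ Γ Θ P K} → induced Σ Γ ⊑ Θ → SynP Σ Γ P K → RespP Θ P
SynP⇒RespP s (p-con _)     = tt
SynP⇒RespP s (p-app p c _) = SynP⇒RespP s p , (_ , Chk⇒ArChk s c)

IsType⇒RespT : ∀ {Σ Γ Θ A} → induced Σ Γ ⊑ Θ → IsType Σ Γ A → RespT Θ A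
IsType⇒RespT s (t-atm p)   = SynP⇒RespP s p
IsType⇒RespT s (t-pi a b) = IsType⇒RespT s a , IsType⇒RespT (⊑-extAr s) b

IsKind⇒RespK : ∀ {Σ Γ Θ K} → induced Σ Γ ⊑ Θ → IsKind Σ Γ K → RespK Θ K
IsKind⇒RespK s k-type     = tt
IsKind⇒RespK s (k-pi a k) = IsType⇒RespT s a , IsKind⇒RespK (⊑-extAr s) k

sigAr⇒∈ : ∀ Σ {c α} → sigAr Σ c ≡ just α → c ∈ map declName Σ
sigAr⇒∈ (tmc d B ∷ Σ) {c} e with d ≟ c
... | yes refl = here refl
... | no _     = there (sigAr⇒∈ Σ e)
sigAr⇒∈ (tyc d K ∷ Σ) e = there (sigAr⇒∈ Σ e)

induced-⊑-tmc : ∀ {Σ d B} → d ∉ map declName Σ → induced Σ [] ⊑ induced (tmc d B ∷ Σ) []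
induced-⊑-tmc {Σ} {d} fresh .con-preserved {c} e with d ≟ c
... | yes refl = ⊥-elim (fresh (sigAr⇒∈ Σ e))
... | no _     = e
induced-⊑-tmc fresh .var-renamed ()

induced-[]-⊑ : ∀ {Σ Γ} → induced Σ [] ⊑ induced Σ Γ
induced-[]-⊑ .con-preserved = id
induced-[]-⊑ .var-renamed ()

induced-weaken : ∀ {Σ Γ B} → Renaming suc (induced Σ Γ) (induced Σ (B ∷ Γ))
induced-weaken .con-preserved = id
induced-weaken .var-renamed   = id

sigTy⇒RespT : ∀ {Σ Θ c A} → SigOK Σ → induced Σ [] ⊑ Θ → sigTy Σ c ≡ just A → RespT Θ A
sigTy⇒RespT {c = c} (sig-tm {Σ} {d} {B} ok fresh ty) s e with d ≟ c
... | yes refl with refl ← e =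
  IsType⇒RespT (⊑-trans {induced Σ []} (induced-⊑-tmc {Σ} {d} {B} fresh) s) ty
... | no _ = sigTy⇒RespT ok (⊑-trans {induced Σ []} (induced-⊑-tmc {Σ} {d} {B} fresh) s) e
sigTy⇒RespT (sig-ty ok _ _) s e = sigTy⇒RespT ok s e

sigKd⇒RespK : ∀ {Σ Θ a K} → SigOK Σ → induced Σ [] ⊑ Θ → sigKd Σ a ≡ just K → RespK Θ K
sigKd⇒RespK {a = a} (sig-ty {Σ} {d} ok _ k) s e with d ≟ a
... | yes refl with refl ← e = IsKind⇒RespK {Σ} s k
... | no _ = sigKd⇒RespK ok s e
sigKd⇒RespK (sig-tm {Σ} {d} {B} ok fresh _) s e =
  sigKd⇒RespK ok (⊑-trans {induced Σ []} (induced-⊑-tmc {Σ} {d} {B} fresh) s) e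

ctxLookup⇒RespT : ∀ {Σ Γ i A} → CtxOK Σ Γ → ctxLookup Γ i ≡ just A → RespT (induced Σ Γ) A
ctxLookup⇒RespT {Σ} {i = zero} (ctx-cons {Γ} {B} ok ty) refl =
  RespT-rename B (induced-weaken {Σ} {Γ} {B}) (IsType⇒RespT {Σ} {Γ} ⊑-refl ty)
ctxLookup⇒RespT {i = suc i} (ctx-cons {Γ} ok ty) e with ctxLookup Γ i in eq
ctxLookup⇒RespT {Σ} (ctx-cons {Γ} {B} ok ty) refl | just A =
  RespT-rename A (induced-weaken {Σ} {Γ} {B}) (ctxLookup⇒RespT ok eq)
ctxLookup⇒RespT (ctx-cons ok ty) () | nothing

AssocTy⇒RespT : ∀ {Σ Γ A} → SigOK Σ → CtxOK Σ Γ → AssocTy Σ Γ A → RespT (induced Σ Γ) A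
AssocTy⇒RespT {Σ} {Γ} sok cok (by-con c e) = sigTy⇒RespT sok (induced-[]-⊑ {Σ} {Γ}) e
AssocTy⇒RespT sok cok (by-var i e) = ctxLookup⇒RespT cok e

RespT-Πs-domains : ∀ Θ As A → RespT Θ (Πs As A) → (i : Fin (length As)) →
  RespT (extMany (take (toℕ i) As) Θ) (lookup As i)
  × RespT (extMany (take (toℕ i) As) Θ) (Πs (drop (toℕ i) As) A)
RespT-Πs-domains Θ (B ∷ Bs) A r@(rB , _) Fin.zero    = rB , r
RespT-Πs-domains Θ (B ∷ Bs) A (_ , rBs)  (Fin.suc i) = RespT-Πs-domains (extAr (erase B) Θ) Bs A rBs i

RespT-Πs-body : ∀ Θ As A → RespT Θ (Πs As A) → RespT (extMany As Θ) A
RespT-Πs-body Θ []       A r         = r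
RespT-Πs-body Θ (B ∷ Bs) A (_ , rBs) = RespT-Πs-body (extAr (erase B) Θ) Bs A rBs

RespK-Πks-domains : ∀ Θ As K → RespK Θ (Πks As K) → (i : Fin (length As)) →
  RespT (extMany (take (toℕ i) As) Θ) (lookup As i)
  × RespK (extMany (take (toℕ i) As) Θ) (Πks (drop (toℕ i) As) K)
RespK-Πks-domains Θ (B ∷ Bs) K r@(rB , _) Fin.zero    = rB , r
RespK-Πks-domains Θ (B ∷ Bs) K (_ , rBs)  (Fin.suc i) = RespK-Πks-domains (extAr (erase B) Θ) Bs K rBs i

RespK-Πks-body : ∀ Θ As K → RespK Θ (Πks As K) → RespK (extMany As Θ) K
RespK-Πks-body Θ []       K r         = r
RespK-Πks-body Θ (B ∷ Bs) K (_ , rBs) = RespK-Πks-body (extAr (erase B) Θ) Bs K rBs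

lemma2p18 : (Σ : Sig) (Γ : Ctx) → SigOK Σ → CtxOK Σ Γ →
    ((As : List Ty) (A : Ty) → AssocTy Σ Γ (Πs As A) →
      ((i : Fin (length As)) →
        RespT (extMany (take (toℕ i) As) (induced Σ Γ)) (lookup As i)
        × RespT (extMany (take (toℕ i) As) (induced Σ Γ)) (Πs (drop (toℕ i) As) A))
      × RespT (extMany As (induced Σ Γ)) A)
    × ((a : ℕ) (As : List Ty) (K : Kd) → sigKd Σ a ≡ just (Πks As K) →
      ((i : Fin (length As)) →
        RespT (extMany (take (toℕ i) As) (induced Σ Γ)) (lookup As i)
        × RespK (extMany (take (toℕ i) As) (induced Σ Γ)) (Πks (drop (toℕ i) As) K))
      × RespK (extMany As (induced Σ Γ)) K)
lemma2p18 Σ Γ sok cok =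
  (λ As A assoc → let r = AssocTy⇒RespT sok cok assoc in
    RespT-Πs-domains (induced Σ Γ) As A r , RespT-Πs-body (induced Σ Γ) As A r) ,
  (λ a As K e → let r = sigKd⇒RespK sok (induced-[]-⊑ {Σ} {Γ}) e in
    RespK-Πks-domains (induced Σ Γ) As K r , RespK-Πks-body (induced Σ Γ) As K r)
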